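{- Let $X=\{e_1,\ldots,e_m\}$, let $\mathcal S\subseteq 2^X$ be any set family, and let $\mathcal S^+\subseteq 2^{X\cup\{e_{m+1}\}}$ be its lifting. Then $\mathcal S^+$ is an even set family, and the 1,2-inclusion graphs $G_{1,2}(\mathcal S)$ and $G_{1,2}(\mathcal S^+)$ are isomorphic.
   Context: Here $e_{m+1}\notin X$ is a new element. The lifting $\mathcal S^+$ consists of all sets of $\mathcal S$ of even cardinality together with all sets $S\cup\{e_{m+1}\}$ for $S\in\mathcal S$ of odd cardinality. A set family is even if all its sets have even cardinality. The 1,2-inclusion graph $G_{1,2}(\mathcal F)$ of a family $\mathcal F$ has vertex set $\mathcal F$, and $A,B\in\mathcal F$ are adjacent iff $1\le|A\triangle B|\le 2$. -}

module Defs where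

open import Data.Nat using (ℕ; zero; suc; _≤_)
open import Data.Bool using (Bool; true; false; not; _∧_; _xor_; T; if_then_else_)
open import Data.Vec using (Vec; []; _∷_; zipWith)
open import Data.Fin.Subset using (Subset; ∣_∣; inside; outside)
open import Data.Product using (Σ; _×_)
open import Function.Bundles using (Bijection; _⇔_)

-- The ground set X = {e_1,…,e_m} is Fin m; a subset of X is a `Subset m`
-- (characteristic vector).  A set family 𝒮 ⊆ 2^X is given by its
-- (Bool-valued) characteristic function on 2^X.
Family : ℕ → Set
Family m = Subset m → Bool

isOdd : ℕ → Bool
isOdd zero = false
isOdd (suc n) = not (isOdd n)

-- The ground set X ∪ {e_{m+1}} is Fin (suc m), where the new
-- element e_{m+1} is the coordinate 0 (the head of the vector) and the old
-- elements are the remaining coordinates.  A set b ∷ S belongs to 𝒮⁺ iff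
-- S ∈ 𝒮 and (b = inside) exactly when |S| is odd; i.e.
-- 𝒮⁺ = {S ∈ 𝒮 : |S| even} ∪ {S ∪ {e_{m+1}} : S ∈ 𝒮, |S| odd}.
lift : {m : ℕ} → Family m → Family (suc m)
lift F (b ∷ S) = F S ∧ (if isOdd ∣ S ∣ then b else not b)

data Even : ℕ → Set where
  even-zero : Even zero
  even-ss   : {n : ℕ} → Even n → Even (suc (suc n))

IsEvenFamily : {m : ℕ} → Family m → Set
IsEvenFamily {m} F = (A : Subset m) → T (F A) → Even ∣ A ∣

_△_ : {m : ℕ} → Subset m → Subset m → Subset m
A △ B = zipWith _xor_ A B

Vertex : {m : ℕ} → Family m → Set
Vertex {m} F = Σ (Subset m) (λ A → T (F A))

Adj : {m : ℕ} (F : Family m) → Vertex F → Vertex F → Set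
Adj F (A Data.Product., _) (B Data.Product., _) = (1 ≤ ∣ A △ B ∣) × (∣ A △ B ∣ ≤ 2)

Isomorphic₁₂ : {m n : ℕ} → Family m → Family n → Set
Isomorphic₁₂ F G =
  Σ (Bijection (≡-setoid (Vertex F)) (≡-setoid (Vertex G))) λ φ →
    (u v : Vertex F) → Adj F u v ⇔ Adj G (Bijection.to φ u) (Bijection.to φ v)
  where open import Relation.Binary.PropositionalEquality using () renaming (setoid to ≡-setoid)

module Submission where

-- Write 𝒮⁺ via the "parity completion" Â = (|A| mod 2) ∷ A of a set
-- A ⊆ X: a set b ∷ A lies in 𝒮⁺ exactly when A ∈ 𝒮 and b is the parity of
-- |A|, i.e. 𝒮⁺ = { Â : A ∈ 𝒮 }.  Every Â has even size |A| rounded up to the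
-- next even number, which gives evenness of 𝒮⁺.  Since parity of size is
-- additive under symmetric difference, Â △ B̂ is the completion of A △ B, so
-- |Â △ B̂| is |A △ B| rounded up to even; rounding up to even fixes 2, sends
-- 1 to 2, keeps 0 and keeps every value ≥ 3 at least 3, hence preserves the
-- condition 1 ≤ d ≤ 2.  Thus A ↦ Â is a graph isomorphism G₁₂(𝒮) ≅ G₁₂(𝒮⁺).

open import Defs
open import Data.Nat using (ℕ; zero; suc; _≤_; s≤s; z≤n)
open import Data.Nat.Properties using (≤-refl; ≤-trans; n≤1+n)
open import Data.Bool using (true; false; not; _xor_; T; if_then_else_)
open import Data.Bool.Properties
  using (not-involutive; if-float; xor-∧-commutativeRing; T-≡; T-not-≡; T-∧; T-irrelevant)
open import Algebra.Bundles using (CommutativeRing)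
open import Algebra.Properties.CommutativeSemigroup
  (CommutativeRing.+-commutativeSemigroup xor-∧-commutativeRing)
  using () renaming (interchange to xor-interchange)
open import Data.Vec using ([]; _∷_)
open import Data.Fin.Subset using (Subset; ∣_∣)
open import Data.Product using (_×_; _,_; proj₁; proj₂)
open import Function.Bundles using (_⤖_; _⇔_; mk⇔; mk↔ₛ′; Equivalence)
open import Function.Properties.Inverse using (↔⇒⤖)
open import Relation.Binary.PropositionalEquality
  using (_≡_; refl; sym; trans; cong; cong₂; subst; module ≡-Reasoning)

open Equivalence using (to; from)

Near : ℕ → Set
Near d = (1 ≤ d) × (d ≤ 2)

roundUpEven : ℕ → ℕ
roundUpEven n = if isOdd n then suc n else n

n≤roundUpEven : ∀ n → n ≤ roundUpEven n
n≤roundUpEven n with isOdd n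
... | true  = n≤1+n n
... | false = ≤-refl

roundUpEven-suc-suc : ∀ n → roundUpEven (suc (suc n)) ≡ suc (suc (roundUpEven n))
roundUpEven-suc-suc n =
  trans (cong (λ b → if b then suc (suc (suc n)) else suc (suc n)) (not-involutive (isOdd n)))
        (sym (if-float (λ k → suc (suc k)) (isOdd n)))

even-roundUpEven : ∀ n → Even (roundUpEven n)
even-roundUpEven zero          = even-zero
even-roundUpEven (suc zero)    = even-ss even-zero
even-roundUpEven (suc (suc n)) =
  subst Even (sym (roundUpEven-suc-suc n)) (even-ss (even-roundUpEven n))

-- Rounding up to even does not change whether 1 ≤ d ≤ 2: it fixes 0 and 2,
-- moves 1 to 2, and keeps every d ≥ 3 above 2.
near-roundUpEven : ∀ d → Near d ⇔ Near (roundUpEven d)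
near-roundUpEven zero                = mk⇔ (λ near → near) (λ near → near)
near-roundUpEven (suc zero)          = mk⇔ (λ _ → s≤s z≤n , s≤s (s≤s z≤n)) (λ _ → s≤s z≤n , s≤s z≤n)
near-roundUpEven (suc (suc zero))    = mk⇔ (λ near → near) (λ near → near)
near-roundUpEven d@(suc (suc (suc _))) = mk⇔ above2 (λ (_ , d′≤2) → above2 (d≥1 , ≤-trans (n≤roundUpEven d) d′≤2))
  where
  d≥1 : 1 ≤ d
  d≥1 = s≤s z≤n
  above2 : ∀ {A : Set} → Near d → A
  above2 (_ , s≤s (s≤s ()))

card-∷ : ∀ {m} b (A : Subset m) → ∣ b ∷ A ∣ ≡ (if b then suc ∣ A ∣ else ∣ A ∣)
card-∷ true  A = refl
card-∷ false A = refl

isOdd-card-∷ : ∀ {m} b (A : Subset m) → isOdd ∣ b ∷ A ∣ ≡ b xor isOdd ∣ A ∣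
isOdd-card-∷ true  A = refl
isOdd-card-∷ false A = refl

isOdd-△ : ∀ {m} (A B : Subset m) → isOdd ∣ A △ B ∣ ≡ isOdd ∣ A ∣ xor isOdd ∣ B ∣
isOdd-△ []      []      = refl
isOdd-△ (a ∷ A) (b ∷ B) = begin
  isOdd ∣ (a xor b) ∷ (A △ B) ∣                  ≡⟨ isOdd-card-∷ (a xor b) (A △ B) ⟩
  (a xor b) xor isOdd ∣ A △ B ∣                  ≡⟨ cong ((a xor b) xor_) (isOdd-△ A B) ⟩
  (a xor b) xor (isOdd ∣ A ∣ xor isOdd ∣ B ∣)    ≡⟨ xor-interchange a b (isOdd ∣ A ∣) (isOdd ∣ B ∣) ⟩
  (a xor isOdd ∣ A ∣) xor (b xor isOdd ∣ B ∣)    ≡⟨ sym (cong₂ _xor_ (isOdd-card-∷ a A) (isOdd-card-∷ b B)) ⟩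
  isOdd ∣ a ∷ A ∣ xor isOdd ∣ b ∷ B ∣            ∎
  where open ≡-Reasoning

complete : ∀ {m} → Subset m → Subset (suc m)
complete A = isOdd ∣ A ∣ ∷ A

card-complete : ∀ {m} (A : Subset m) → ∣ complete A ∣ ≡ roundUpEven ∣ A ∣
card-complete A = card-∷ (isOdd ∣ A ∣) A

complete-△ : ∀ {m} (A B : Subset m) → complete A △ complete B ≡ complete (A △ B)
complete-△ A B = cong (_∷ A △ B) (sym (isOdd-△ A B))

T-parityTest : ∀ c b → T (if c then b else not b) ⇔ (b ≡ c)
T-parityTest true  b = T-≡
T-parityTest false b = T-not-≡

lift-∈ : ∀ {m} (S : Family m) b (A : Subset m) →
         T (lift S (b ∷ A)) ⇔ (T (S A) × b ≡ isOdd ∣ A ∣)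
lift-∈ S b A = mk⇔
  (λ b∷A∈S⁺ → let (A∈S , test) = to T-∧ b∷A∈S⁺ in A∈S , to (T-parityTest (isOdd ∣ A ∣) b) test)
  (λ (A∈S , b≡parity) → from T-∧ (A∈S , from (T-parityTest (isOdd ∣ A ∣) b) b≡parity))

lift-even : ∀ {m} (S : Family m) → IsEvenFamily (lift S)
lift-even S (b ∷ A) b∷A∈S⁺ with proj₂ (to (lift-∈ S b A) b∷A∈S⁺)
... | refl = subst Even (sym (card-complete A)) (even-roundUpEven ∣ A ∣)

vertex-≡ : ∀ {m} (F : Family m) {A B : Subset m} {p : T (F A)} {q : T (F B)} →
           A ≡ B → _≡_ {A = Vertex F} (A , p) (B , q)
vertex-≡ F refl = cong (_ ,_) (T-irrelevant _ _)

module Completion {m : ℕ} (S : Family m) where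

  toLift : Vertex S → Vertex (lift S)
  toLift (A , A∈S) = complete A , from (lift-∈ S _ A) (A∈S , refl)

  fromLift : Vertex (lift S) → Vertex S
  fromLift (b ∷ A , b∷A∈S⁺) = A , proj₁ (to (lift-∈ S b A) b∷A∈S⁺)

  toLift-fromLift : ∀ v → toLift (fromLift v) ≡ v
  toLift-fromLift (b ∷ A , b∷A∈S⁺) with to (lift-∈ S b A) b∷A∈S⁺
  ... | _ , refl = vertex-≡ (lift S) refl

  fromLift-toLift : ∀ u → fromLift (toLift u) ≡ u
  fromLift-toLift _ = vertex-≡ S refl

  vertexBijection : Vertex S ⤖ Vertex (lift S)
  vertexBijection = ↔⇒⤖ (mk↔ₛ′ toLift fromLift toLift-fromLift fromLift-toLift)

  adjacency : (u v : Vertex S) → Adj S u v ⇔ Adj (lift S) (toLift u) (toLift v)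
  adjacency (A , _) (B , _) =
    subst (λ d → Near ∣ A △ B ∣ ⇔ Near d) completedDistance (near-roundUpEven ∣ A △ B ∣)
    where
    completedDistance : roundUpEven ∣ A △ B ∣ ≡ ∣ complete A △ complete B ∣
    completedDistance = trans (sym (card-complete (A △ B))) (cong ∣_∣ (sym (complete-△ A B)))

lemma1 : (m : ℕ) (S : Family m) → IsEvenFamily (lift S) × Isomorphic₁₂ S (lift S)
lemma1 m S = lift-even S , vertexBijection , adjacency
  where open Completion S
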